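{- Let $n\ge 1$ and let $A$ and $B$ be two $n\times n\times n$ alternating sign hypermatrices. Then $A-B$ can be expressed as a (finite, possibly empty) sum of T-blocks.
   Context: An $n\times n\times n$ hypermatrix $A=[a_{ijk}]$ ($1\le i,j,k\le n$) has row lines $(a_{ijk})_{i=1}^n$ (for fixed $j,k$), column lines $(a_{ijk})_{j=1}^n$ (for fixed $i,k$) and vertical lines $(a_{ijk})_{k=1}^n$ (for fixed $i,j$). An alternating sign hypermatrix (ASHM) is an $n\times n\times n$ hypermatrix with entries in $\{0,1,-1\}$ such that in every row line, column line and vertical line the non-zero entries alternate in sign, beginning and ending with $+1$. For indices $i_1<i_2$, $j_1<j_2$, $k_1<k_2$ in $\{1,\dots,n\}$, the hypermatrix $T_{i_1,j_1,k_1:\,i_2,j_2,k_2}=[t_{ijk}]$ has $t_{ijk}=1$ for $(i,j,k)\in\{(i_1,j_1,k_1),(i_2,j_2,k_1),(i_2,j_1,k_2),(i_1,j_2,k_2)\}$, $t_{ijk}=-1$ for $(i,j,k)\in\{(i_2,j_1,k_1),(i_1,j_2,k_1),(i_1,j_1,k_2),(i_2,j_2,k_2)\}$, and $t_{ijk}=0$ otherwise. A T-block is a hypermatrix of the form $T_{i_1,j_1,k_1:\,i_2,j_2,k_2}$ or $-T_{i_1,j_1,k_1:\,i_2,j_2,k_2}$ with $i_1<i_2$, $j_1<j_2$, $k_1<k_2$. -}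

module Defs where

open import Data.Nat using (ℕ)
open import Data.Integer using (ℤ; +_; -_; _+_; _-_; -1ℤ; 0ℤ; 1ℤ)
open import Data.Fin using (Fin; _<_)
open import Data.Fin.Properties using (_≟_)
open import Data.Bool using (Bool; true; false; if_then_else_; _∧_)
open import Data.List using (List; []; _∷_; filter; map; foldr)
open import Data.List using () renaming (tabulate to tabulateL)
open import Data.Product using (_×_)
open import Data.Sum using (_⊎_)
open import Relation.Binary.PropositionalEquality using (_≡_)
open import Relation.Nullary using (¬_; Dec; ¬?)
open import Relation.Nullary.Decidable using (⌊_⌋)
import Data.Integer.Properties as ℤP

Hypermatrix : ℕ → Set
Hypermatrix n = Fin n → Fin n → Fin n → ℤ

IsSignEntry : ℤ → Set
IsSignEntry x = (x ≡ 0ℤ) ⊎ ((x ≡ 1ℤ) ⊎ (x ≡ -1ℤ))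

data AltSeq : List ℤ → Set where
  single : AltSeq (1ℤ ∷ [])
  cons   : ∀ {xs} → AltSeq xs → AltSeq (1ℤ ∷ -1ℤ ∷ xs)

nonzeros : ∀ {n} → (Fin n → ℤ) → List ℤ
nonzeros {n} v = filter (λ x → ¬? (x ℤP.≟ 0ℤ)) (tabulateL v)

AltLine : ∀ {n} → (Fin n → ℤ) → Set
AltLine v = AltSeq (nonzeros v)

record IsASHM {n : ℕ} (A : Hypermatrix n) : Set where
  field
    entries  : ∀ i j k → IsSignEntry (A i j k)
    rows     : ∀ j k → AltLine (λ i → A i j k)
    columns  : ∀ i k → AltLine (λ j → A i j k)
    verticals : ∀ i j → AltLine (λ k → A i j k)

_−H_ : ∀ {n} → Hypermatrix n → Hypermatrix n → Hypermatrix n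
(A −H B) i j k = A i j k - B i j k

_+H_ : ∀ {n} → Hypermatrix n → Hypermatrix n → Hypermatrix n
(A +H B) i j k = A i j k + B i j k

negH : ∀ {n} → Hypermatrix n → Hypermatrix n
negH A i j k = - A i j k

zeroH : ∀ {n} → Hypermatrix n
zeroH i j k = 0ℤ

_==_ : ∀ {n} → Fin n → Fin n → Bool
a == b = ⌊ a ≟ b ⌋

T : ∀ {n} → (i₁ j₁ k₁ i₂ j₂ k₂ : Fin n) → Hypermatrix n
T i₁ j₁ k₁ i₂ j₂ k₂ i j k =
  if      (i == i₁) ∧ (j == j₁) ∧ (k == k₁) then 1ℤ
  else if (i == i₂) ∧ (j == j₂) ∧ (k == k₁) then 1ℤ
  else if (i == i₂) ∧ (j == j₁) ∧ (k == k₂) then 1ℤ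
  else if (i == i₁) ∧ (j == j₂) ∧ (k == k₂) then 1ℤ
  else if (i == i₂) ∧ (j == j₁) ∧ (k == k₁) then -1ℤ
  else if (i == i₁) ∧ (j == j₂) ∧ (k == k₁) then -1ℤ
  else if (i == i₁) ∧ (j == j₁) ∧ (k == k₂) then -1ℤ
  else if (i == i₂) ∧ (j == j₂) ∧ (k == k₂) then -1ℤ
  else 0ℤ

record TBlockData (n : ℕ) : Set where
  constructor tblock
  field
    positive : Bool
    i₁ j₁ k₁ i₂ j₂ k₂ : Fin n
    i₁<i₂ : i₁ < i₂
    j₁<j₂ : j₁ < j₂
    k₁<k₂ : k₁ < k₂

toHM : ∀ {n} → TBlockData n → Hypermatrix n
toHM (tblock true  i₁ j₁ k₁ i₂ j₂ k₂ _ _ _) = T i₁ j₁ k₁ i₂ j₂ k₂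
toHM (tblock false i₁ j₁ k₁ i₂ j₂ k₂ _ _ _) = negH (T i₁ j₁ k₁ i₂ j₂ k₂)

sumTBlocks : ∀ {n} → List (TBlockData n) → Hypermatrix n
sumTBlocks = foldr (λ t acc → toHM t +H acc) zeroH

module Submission where

-- Every line of an ASHM sums to 1, so D = A − B has all line sums 0.
-- For x₁ ≢ x₂ let  step x₁ x₂ = e_{x₂} − e_{x₁}; then −T_{x₁y₁z₁:x₂y₂z₂} is
-- the tensor product  step x₁ x₂ ⊗ step y₁ y₂ ⊗ step z₁ z₂.  In one dimension,
-- a vector v indexed by {0,…,m} with sum 0 satisfies
--     v = Σ_{i<m} v(i+1) · (e_{i+1} − e_0),
-- and applying this along rows, columns and verticals gives the corner expansion
--     D = Σ_{i,j,k<m} D(i+1,j+1,k+1) · (−T_{0,0,0 : i+1,j+1,k+1}).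
-- An integer multiple d·(−T) is a list of |d| copies of −T (or of T if d < 0).

open import Defs
open import Data.Nat using (ℕ; _≥_; zero; suc; s≤s; z≤n)
open import Data.Fin using (Fin; zero; suc)
open import Data.Fin.Properties using (_≟_)
open import Data.Bool using (Bool; true; false; not)
open import Data.Integer using (ℤ; +_; -_; _+_; _-_; _*_; -1ℤ; 0ℤ; 1ℤ; -[1+_])
import Data.Integer.Properties as ℤP
open import Data.Integer.Tactic.RingSolver using (solve-∀)
open import Data.List using (List; []; _∷_; _++_; replicate; filter; foldr; concat)
  renaming (tabulate to tabulateL)
open import Data.Product using (∃; _,_)
open import Data.Empty using (⊥-elim)
open import Relation.Binary.PropositionalEquality
  using (_≡_; _≢_; refl; sym; trans; cong; cong₂; module ≡-Reasoning)
open import Relation.Nullary using (yes; no; ¬?)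
open import Algebra.Properties.Semiring.Sum ℤP.+-*-semiring
  using (sum; sum-syntax; sum-cong-≗; sum-replicate-zero; *-distribˡ-sum; ∑-distrib-+)
open import Algebra.Properties.AbelianGroup ℤP.+-0-abelianGroup using (inverseˡ-unique)

open ≡-Reasoning

listSum : List ℤ → ℤ
listSum = foldr _+_ 0ℤ

listSum-tabulate : ∀ {m} (v : Fin m → ℤ) → listSum (tabulateL v) ≡ sum v
listSum-tabulate {zero}  v = refl
listSum-tabulate {suc m} v = cong (λ s → v zero + s) (listSum-tabulate (λ i → v (suc i)))

listSum-nonzero : (xs : List ℤ) → listSum (filter (λ x → ¬? (x ℤP.≟ 0ℤ)) xs) ≡ listSum xs
listSum-nonzero []       = refl
listSum-nonzero (x ∷ xs) with x ℤP.≟ 0ℤ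
... | yes refl = trans (listSum-nonzero xs) (sym (ℤP.+-identityˡ (listSum xs)))
... | no  _    = cong (λ s → x + s) (listSum-nonzero xs)

listSum-alternating : ∀ {xs} → AltSeq xs → listSum xs ≡ 1ℤ
listSum-alternating single   = refl
listSum-alternating (cons a) = cong (λ s → 1ℤ + (-1ℤ + s)) (listSum-alternating a)

alternating-line-sum : ∀ {m} (v : Fin m → ℤ) → AltLine v → sum v ≡ 1ℤ
alternating-line-sum v alt = begin
  sum v                        ≡⟨ sym (listSum-tabulate v) ⟩
  listSum (tabulateL v)        ≡⟨ sym (listSum-nonzero (tabulateL v)) ⟩
  listSum (nonzeros v)         ≡⟨ listSum-alternating alt ⟩
  1ℤ                           ∎

record ZeroLineSums {n : ℕ} (D : Hypermatrix n) : Set where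
  field
    rows      : ∀ j k → ∑[ i < n ] D i j k ≡ 0ℤ
    columns   : ∀ i k → ∑[ j < n ] D i j k ≡ 0ℤ
    verticals : ∀ i j → ∑[ k < n ] D i j k ≡ 0ℤ

sum-neg : ∀ {m} (w : Fin m → ℤ) → ∑[ i < m ] (- w i) ≡ - sum w
sum-neg w = begin
  ∑[ i < _ ] (- w i)     ≡⟨ sum-cong-≗ (λ i → sym (ℤP.-1*i≡-i (w i))) ⟩
  ∑[ i < _ ] (-1ℤ * w i) ≡⟨ sym (*-distribˡ-sum -1ℤ w) ⟩
  -1ℤ * sum w            ≡⟨ ℤP.-1*i≡-i (sum w) ⟩
  - sum w                ∎

sum-difference : ∀ {m} (v w : Fin m → ℤ) → sum v ≡ sum w → ∑[ i < m ] (v i - w i) ≡ 0ℤ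
sum-difference v w eq = begin
  ∑[ i < _ ] (v i - w i)   ≡⟨ ∑-distrib-+ v (λ i → - w i) ⟩
  sum v + ∑[ i < _ ] (- w i) ≡⟨ cong₂ (λ x y → x + y) eq (sum-neg w) ⟩
  sum w - sum w            ≡⟨ ℤP.+-inverseʳ (sum w) ⟩
  0ℤ                       ∎

ashm-difference-zeroLineSums : ∀ {n} {A B : Hypermatrix n} → IsASHM A → IsASHM B →
  ZeroLineSums (A −H B)
ashm-difference-zeroLineSums {A = A} {B} hA hB = record
  { rows      = λ j k → balanced (λ i → A i j k) (λ i → B i j k) (rows hA j k) (rows hB j k)
  ; columns   = λ i k → balanced (λ j → A i j k) (λ j → B i j k) (columns hA i k) (columns hB i k)
  ; verticals = λ i j → balanced (λ k → A i j k) (λ k → B i j k) (verticals hA i j) (verticals hB i j)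
  }
  where
  open IsASHM
  balanced : ∀ {m} (v w : Fin m → ℤ) → AltLine v → AltLine w → ∑[ i < m ] (v i - w i) ≡ 0ℤ
  balanced v w av aw =
    sum-difference v w (trans (alternating-line-sum v av) (sym (alternating-line-sum w aw)))

-- T is a tensor product of three "steps"

-- How an index a relates to two distinct indices x₁, x₂, recorded on the
-- pair of tests (a == x₁ , a == x₂).
data Position : Bool → Bool → Set where
  atFirst   : Position true  false
  atSecond  : Position false true
  elsewhere : Position false false

position : ∀ {n} {x₁ x₂ : Fin n} → x₁ ≢ x₂ → (a : Fin n) → Position (a == x₁) (a == x₂)
position {x₁ = x₁} {x₂} x₁≢x₂ a with a ≟ x₁ | a ≟ x₂
... | yes refl | yes refl = ⊥-elim (x₁≢x₂ refl)
... | yes _    | no  _    = atFirst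
... | no  _    | yes _    = atSecond
... | no  _    | no  _    = elsewhere

-- Value of e_{x₂} − e_{x₁} at an index, given the two tests.
weight : Bool → Bool → ℤ
weight true  _     = -1ℤ
weight false true  = 1ℤ
weight false false = 0ℤ

step : ∀ {n} → Fin n → Fin n → Fin n → ℤ
step x₁ x₂ a = weight (a == x₁) (a == x₂)

−T-factorisation : ∀ {n} {x₁ y₁ z₁ x₂ y₂ z₂ : Fin n} →
  x₁ ≢ x₂ → y₁ ≢ y₂ → z₁ ≢ z₂ → ∀ a b c →
  negH (T x₁ y₁ z₁ x₂ y₂ z₂) a b c ≡ step x₁ x₂ a * (step y₁ y₂ b * step z₁ z₂ c)
−T-factorisation {x₁ = x₁} {y₁} {z₁} {x₂} {y₂} {z₂} x₁≢x₂ y₁≢y₂ z₁≢z₂ a b c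
  with a == x₁ | a == x₂ | position x₁≢x₂ a
     | b == y₁ | b == y₂ | position y₁≢y₂ b
     | c == z₁ | c == z₂ | position z₁≢z₂ c
... | _ | _ | elsewhere | _ | _ | _         | _ | _ | _         = refl
... | _ | _ | atFirst   | _ | _ | elsewhere | _ | _ | _         = refl
... | _ | _ | atSecond  | _ | _ | elsewhere | _ | _ | _         = refl
... | _ | _ | atFirst   | _ | _ | atFirst   | _ | _ | elsewhere = refl
... | _ | _ | atFirst   | _ | _ | atSecond  | _ | _ | elsewhere = refl
... | _ | _ | atSecond  | _ | _ | atFirst   | _ | _ | elsewhere = refl
... | _ | _ | atSecond  | _ | _ | atSecond  | _ | _ | elsewhere = refl
... | _ | _ | atFirst   | _ | _ | atFirst   | _ | _ | atFirst   = refl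
... | _ | _ | atFirst   | _ | _ | atFirst   | _ | _ | atSecond  = refl
... | _ | _ | atFirst   | _ | _ | atSecond  | _ | _ | atFirst   = refl
... | _ | _ | atFirst   | _ | _ | atSecond  | _ | _ | atSecond  = refl
... | _ | _ | atSecond  | _ | _ | atFirst   | _ | _ | atFirst   = refl
... | _ | _ | atSecond  | _ | _ | atFirst   | _ | _ | atSecond  = refl
... | _ | _ | atSecond  | _ | _ | atSecond  | _ | _ | atFirst   = refl
... | _ | _ | atSecond  | _ | _ | atSecond  | _ | _ | atSecond  = refl

-- One-dimensional inversion

suc-== : ∀ {m} (a i : Fin m) → (suc a == suc i) ≡ (a == i)
suc-== a i with a ≟ i
... | yes _ = refl
... | no  _ = refl

sum-indicator : ∀ {m} (a : Fin m) (f : Fin m → ℤ) → ∑[ i < m ] (weight false (a == i) * f i) ≡ f a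
sum-indicator {suc m} zero f = begin
  1ℤ * f zero + ∑[ i < m ] 0ℤ ≡⟨ cong₂ (λ x y → x + y) (ℤP.*-identityˡ (f zero)) (sum-replicate-zero m) ⟩
  f zero + 0ℤ                 ≡⟨ ℤP.+-identityʳ (f zero) ⟩
  f zero                      ∎
sum-indicator {suc m} (suc a) f = begin
  0ℤ + ∑[ i < m ] (weight false (suc a == suc i) * f (suc i))
    ≡⟨ ℤP.+-identityˡ _ ⟩
  ∑[ i < m ] (weight false (suc a == suc i) * f (suc i))
    ≡⟨ sum-cong-≗ (λ i → cong (λ t → weight false t * f (suc i)) (suc-== a i)) ⟩
  ∑[ i < m ] (weight false (a == i) * f (suc i))
    ≡⟨ sum-indicator a (λ i → f (suc i)) ⟩
  f (suc a) ∎

step-inversion : ∀ {m} (v : Fin (suc m) → ℤ) → sum v ≡ 0ℤ →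
  ∀ a → ∑[ i < m ] (step zero (suc i) a * v (suc i)) ≡ v a
step-inversion {m} v sum≡0 zero = begin
  ∑[ i < m ] (-1ℤ * v (suc i))  ≡⟨ sym (*-distribˡ-sum -1ℤ (λ i → v (suc i))) ⟩
  -1ℤ * ∑[ i < m ] v (suc i)    ≡⟨ ℤP.-1*i≡-i _ ⟩
  - ∑[ i < m ] v (suc i)        ≡⟨ sym (inverseˡ-unique (v zero) _ sum≡0) ⟩
  v zero                        ∎
step-inversion {m} v sum≡0 (suc a) = begin
  ∑[ i < m ] (weight false (suc a == suc i) * v (suc i))
    ≡⟨ sum-cong-≗ (λ i → cong (λ t → weight false t * v (suc i)) (suc-== a i)) ⟩
  ∑[ i < m ] (weight false (a == i) * v (suc i))
    ≡⟨ sum-indicator a (λ i → v (suc i)) ⟩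
  v (suc a) ∎

-- Corner expansion of a hypermatrix with zero line sums

corner-expansion : ∀ {m} (D : Hypermatrix (suc m)) → ZeroLineSums D → ∀ a b c →
  D a b c ≡ ∑[ i < m ] ∑[ j < m ] ∑[ k < m ]
              (D (suc i) (suc j) (suc k) * negH (T zero zero zero (suc i) (suc j) (suc k)) a b c)
corner-expansion {m} D zero-sums a b c = begin
  D a b c
    ≡⟨ sym (step-inversion (λ i → D i b c) (rows b c) a) ⟩
  ∑[ i < m ] (s i a * D (suc i) b c)
    ≡⟨ sum-cong-≗ (λ i → cong (s i a *_)
         (sym (step-inversion (λ j → D (suc i) j c) (columns (suc i) c) b))) ⟩
  ∑[ i < m ] (s i a * ∑[ j < m ] (s j b * D (suc i) (suc j) c))
    ≡⟨ sum-cong-≗ (λ i → cong (s i a *_) (sum-cong-≗ (λ j → cong (s j b *_)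
         (sym (step-inversion (λ k → D (suc i) (suc j) k) (verticals (suc i) (suc j)) c))))) ⟩
  ∑[ i < m ] (s i a * ∑[ j < m ] (s j b * ∑[ k < m ] (s k c * D (suc i) (suc j) (suc k))))
    ≡⟨ sum-cong-≗ (λ i → *-distribˡ-sum (s i a)
         (λ j → s j b * ∑[ k < m ] (s k c * D (suc i) (suc j) (suc k)))) ⟩
  ∑[ i < m ] ∑[ j < m ] (s i a * (s j b * ∑[ k < m ] (s k c * D (suc i) (suc j) (suc k))))
    ≡⟨ sum-cong-≗ (λ i → sum-cong-≗ (λ j → cong (s i a *_)
         (*-distribˡ-sum (s j b) (λ k → s k c * D (suc i) (suc j) (suc k))))) ⟩
  ∑[ i < m ] ∑[ j < m ] (s i a * ∑[ k < m ] (s j b * (s k c * D (suc i) (suc j) (suc k))))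
    ≡⟨ sum-cong-≗ (λ i → sum-cong-≗ (λ j →
         *-distribˡ-sum (s i a) (λ k → s j b * (s k c * D (suc i) (suc j) (suc k))))) ⟩
  ∑[ i < m ] ∑[ j < m ] ∑[ k < m ] (s i a * (s j b * (s k c * D (suc i) (suc j) (suc k))))
    ≡⟨ sum-cong-≗ (λ i → sum-cong-≗ (λ j → sum-cong-≗ (λ k → term i j k))) ⟩
  ∑[ i < m ] ∑[ j < m ] ∑[ k < m ]
    (D (suc i) (suc j) (suc k) * negH (T zero zero zero (suc i) (suc j) (suc k)) a b c) ∎
  where
  open ZeroLineSums zero-sums
  s : Fin m → Fin (suc m) → ℤ
  s i = step zero (suc i)

  reorder : ∀ x y z d → x * (y * (z * d)) ≡ d * (x * (y * z))
  reorder = solve-∀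

  term : ∀ i j k → s i a * (s j b * (s k c * D (suc i) (suc j) (suc k)))
                 ≡ D (suc i) (suc j) (suc k) * negH (T zero zero zero (suc i) (suc j) (suc k)) a b c
  term i j k = trans (reorder (s i a) (s j b) (s k c) _)
    (cong (D (suc i) (suc j) (suc k) *_) (sym (−T-factorisation (λ ()) (λ ()) (λ ()) a b c)))

sumTBlocks-++ : ∀ {n} (xs ys : List (TBlockData n)) a b c →
  sumTBlocks (xs ++ ys) a b c ≡ sumTBlocks xs a b c + sumTBlocks ys a b c
sumTBlocks-++ []       ys a b c = sym (ℤP.+-identityˡ _)
sumTBlocks-++ (t ∷ xs) ys a b c = begin
  toHM t a b c + sumTBlocks (xs ++ ys) a b c
    ≡⟨ cong (λ s → toHM t a b c + s) (sumTBlocks-++ xs ys a b c) ⟩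
  toHM t a b c + (sumTBlocks xs a b c + sumTBlocks ys a b c)
    ≡⟨ sym (ℤP.+-assoc (toHM t a b c) _ _) ⟩
  toHM t a b c + sumTBlocks xs a b c + sumTBlocks ys a b c ∎

sumTBlocks-concat : ∀ {m n} (f : Fin m → List (TBlockData n)) a b c →
  sumTBlocks (concat (tabulateL f)) a b c ≡ ∑[ i < m ] sumTBlocks (f i) a b c
sumTBlocks-concat {zero}  f a b c = refl
sumTBlocks-concat {suc m} f a b c =
  trans (sumTBlocks-++ (f zero) _ a b c)
        (cong (λ s → sumTBlocks (f zero) a b c + s) (sumTBlocks-concat (λ i → f (suc i)) a b c))

sumTBlocks-replicate : ∀ {n} r (t : TBlockData n) a b c →
  sumTBlocks (replicate r t) a b c ≡ + r * toHM t a b c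
sumTBlocks-replicate zero    t a b c = refl
sumTBlocks-replicate (suc r) t a b c = begin
  toHM t a b c + sumTBlocks (replicate r t) a b c ≡⟨ cong (λ s → toHM t a b c + s) (sumTBlocks-replicate r t a b c) ⟩
  toHM t a b c + + r * toHM t a b c               ≡⟨ sym (ℤP.suc-* (+ r) (toHM t a b c)) ⟩
  + suc r * toHM t a b c                          ∎

flip : ∀ {n} → TBlockData n → TBlockData n
flip (tblock s i₁ j₁ k₁ i₂ j₂ k₂ i₁<i₂ j₁<j₂ k₁<k₂) =
  tblock (not s) i₁ j₁ k₁ i₂ j₂ k₂ i₁<i₂ j₁<j₂ k₁<k₂

toHM-flip : ∀ {n} (t : TBlockData n) a b c → toHM (flip t) a b c ≡ - toHM t a b c
toHM-flip (tblock true  _ _ _ _ _ _ _ _ _) a b c = refl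
toHM-flip (tblock false _ _ _ _ _ _ _ _ _) a b c = sym (ℤP.neg-involutive _)

multiple : ∀ {n} → ℤ → TBlockData n → List (TBlockData n)
multiple (+ r)    t = replicate r t
multiple -[1+ p ] t = replicate (suc p) (flip t)

sumTBlocks-multiple : ∀ {n} d (t : TBlockData n) a b c →
  sumTBlocks (multiple d t) a b c ≡ d * toHM t a b c
sumTBlocks-multiple (+ r)    t a b c = sumTBlocks-replicate r t a b c
sumTBlocks-multiple -[1+ p ] t a b c = begin
  sumTBlocks (replicate (suc p) (flip t)) a b c ≡⟨ sumTBlocks-replicate (suc p) (flip t) a b c ⟩
  + suc p * toHM (flip t) a b c                 ≡⟨ cong (+ suc p *_) (toHM-flip t a b c) ⟩
  + suc p * - toHM t a b c                      ≡⟨ sym (ℤP.neg-distribʳ-* (+ suc p) _) ⟩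
  - (+ suc p * toHM t a b c)                    ≡⟨ ℤP.neg-distribˡ-* (+ suc p) _ ⟩
  -[1+ p ] * toHM t a b c                       ∎

cornerBlock : ∀ {m} → Fin m → Fin m → Fin m → TBlockData (suc m)
cornerBlock i j k = tblock false zero zero zero (suc i) (suc j) (suc k) (s≤s z≤n) (s≤s z≤n) (s≤s z≤n)

zeroLineSums⇒sumOfTBlocks : ∀ {m} (D : Hypermatrix (suc m)) → ZeroLineSums D →
  ∃ λ (ts : List (TBlockData (suc m))) → ∀ a b c → D a b c ≡ sumTBlocks ts a b c
zeroLineSums⇒sumOfTBlocks {m} D zero-sums = blocks , λ a b c → begin
  D a b c
    ≡⟨ corner-expansion D zero-sums a b c ⟩
  ∑[ i < m ] ∑[ j < m ] ∑[ k < m ] (coefficient i j k * toHM (cornerBlock i j k) a b c)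
    ≡⟨ sum-cong-≗ (λ i → sum-cong-≗ (λ j → sum-cong-≗ (λ k →
         sym (sumTBlocks-multiple (coefficient i j k) (cornerBlock i j k) a b c)))) ⟩
  ∑[ i < m ] ∑[ j < m ] ∑[ k < m ] sumTBlocks (cornerBlocks i j k) a b c
    ≡⟨ sym (sum-cong-≗ (λ i → trans (sumTBlocks-concat (λ j → concat (tabulateL (cornerBlocks i j))) a b c)
         (sum-cong-≗ (λ j → sumTBlocks-concat (cornerBlocks i j) a b c)))) ⟩
  ∑[ i < m ] sumTBlocks (concat (tabulateL (λ j → concat (tabulateL (cornerBlocks i j))))) a b c
    ≡⟨ sym (sumTBlocks-concat (λ i → concat (tabulateL (λ j → concat (tabulateL (cornerBlocks i j))))) a b c) ⟩
  sumTBlocks blocks a b c ∎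
  where
  coefficient : Fin m → Fin m → Fin m → ℤ
  coefficient i j k = D (suc i) (suc j) (suc k)

  cornerBlocks : Fin m → Fin m → Fin m → List (TBlockData (suc m))
  cornerBlocks i j k = multiple (coefficient i j k) (cornerBlock i j k)

  blocks : List (TBlockData (suc m))
  blocks = concat (tabulateL (λ i → concat (tabulateL (λ j → concat (tabulateL (cornerBlocks i j))))))

lemma9 : (n : ℕ) → n ≥ 1 → (A B : Hypermatrix n) → IsASHM A → IsASHM B →
    ∃ λ (ts : List (TBlockData n)) → ∀ i j k → (A −H B) i j k ≡ sumTBlocks ts i j k
lemma9 (suc m) _ A B hA hB =
  zeroLineSums⇒sumOfTBlocks (A −H B) (ashm-difference-zeroLineSums hA hB)
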